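{- Consider keys $\{1,\dots,15\}$ with weights $p_1=p_{15}=7$, $p_k=5$ for even $k$, and $p_k=0$ for odd $k\in\{3,5,\dots,13\}$. For $1\le\ell\le14$ let $I_\ell=\{1,\dots,\ell\}$ and $q_\ell=1+\lfloor\ell/2\rfloor$ (the number of positive-weight keys in $I_\ell$). Let $\ell\le14$ and $h'$ be such that $q_\ell-h'=4$, and let $T'$ be an optimal tree for the subproblem $(I_\ell,h')$. Then $T'$ has weight $22$ and cost $49$.
   Context: A two-way-comparison search tree for a query set $S$ is a rooted binary tree whose internal nodes each have two children and are labeled by a key and an operator (equality or less-than), with $|S|$ leaves labeled by distinct elements of $S$; the search for $v$ follows comparison outcomes from the root, and the tree is correct if the search for each $v\in S$ ends at the leaf labeled $v$. Its cost is $\sum_{v\in S}p_v\,\mathrm{depth}(v)$ and its weight is $\sum_{v\in S}p_v$. An optimal tree for the subproblem $(I,h)$ is a correct tree of minimum cost among all correct trees for query sets $I\setminus H$ with $H\subseteq I$, $|H|=h$. -}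

module Defs where

open import Data.Nat using (ℕ; zero; suc; _+_; _*_; _≤_; _<_; _<?_; _/_; _%_)
open import Data.Nat.Properties using (_≟_)
open import Data.List using (List; []; _∷_; _++_; length)
open import Data.List.Membership.Propositional using (_∈_)
open import Data.List.Relation.Unary.Unique.Propositional using (Unique)
open import Data.List.Relation.Unary.All using (All)
open import Data.Product using (Σ; _×_; _,_)
open import Relation.Nullary using (¬_; yes; no)
open import Relation.Binary.PropositionalEquality using (_≡_)
open import Function.Bundles using (_⇔_)

data Op : Set where
  eqOp : Op
  ltOp : Op

-- Two-way-comparison search trees: internal nodes have two children and a
-- (operator, key) label; leaves carry a query value.
-- Convention: the left child is taken when the comparison succeeds.
data Tree : Set where
  leaf : ℕ → Tree
  node : Op → ℕ → Tree → Tree → Tree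

search : Tree → ℕ → ℕ
search (leaf u) v = u
search (node eqOp k l r) v with v ≟ k
... | yes _ = search l v
... | no  _ = search r v
search (node ltOp k l r) v with v <? k
... | yes _ = search l v
... | no  _ = search r v

leaves : Tree → List ℕ
leaves (leaf u) = u ∷ []
leaves (node _ _ l r) = leaves l ++ leaves r

Correct : (ℕ → Set) → Tree → Set
Correct S T =
  Unique (leaves T)
  × (∀ v → (v ∈ leaves T) ⇔ S v)
  × (∀ v → S v → search T v ≡ v)

-- Weights: p₁ = p₁₅ = 7, p_k = 5 for even k, p_k = 0 for odd k ∈ {3,…,13}.
-- (Values outside {1,…,15} are never queried.)
p : ℕ → ℕ
p 1  = 7
p 15 = 7
p k with k % 2
... | 0 = 5
... | _ = 0

costFrom : ℕ → Tree → ℕ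
costFrom d (leaf u) = p u * d
costFrom d (node _ _ l r) = costFrom (suc d) l + costFrom (suc d) r

cost : Tree → ℕ
cost = costFrom 0

weight : Tree → ℕ
weight (leaf u) = p u
weight (node _ _ l r) = weight l + weight r

Iℓ : ℕ → ℕ → Set
Iℓ ℓ x = (1 ≤ x) × (x ≤ ℓ)

q : ℕ → ℕ
q ℓ = 1 + ℓ / 2

Diff : ℕ → List ℕ → ℕ → Set
Diff ℓ H x = Iℓ ℓ x × ¬ (x ∈ H)

ValidH : ℕ → ℕ → List ℕ → Set
ValidH ℓ h H = Unique H × All (Iℓ ℓ) H × (length H ≡ h)

CorrectSub : ℕ → ℕ → Tree → Set
CorrectSub ℓ h T = Σ (List ℕ) λ H → ValidH ℓ h H × Correct (Diff ℓ H) T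

Optimal : ℕ → ℕ → Tree → Set
Optimal ℓ h T = CorrectSub ℓ h T × (∀ T' → CorrectSub ℓ h T' → cost T ≤ cost T')

-- A correct tree for (I_ℓ, h′) must keep at least 4 of the h′ + 4 keys of positive weight and at
-- least one key of weight 0, and an explicit tree of cost 49 bounds its cost from above. Its cost
-- is at least the Huffman optimum of its weight multiset; tabulating that optimum on counts capped
-- at 4 sevens, 5 fives and 1 zero keeps the merge inequality a finite check. The only admissible
-- profiles of optimum ≤ 49 are one 7 with three 5s (optimum 49, weight 22) and four 5s (optimum 45). In the
-- second case H contains only positive keys, so every odd key below the largest leaf is a leaf; the
-- children of a less-than root are then convex, so a child holding two even keys also holds the odd
-- key between them, while an equality root splits off a single leaf. Either way the cost is ≥ 50.
module Submission where

open import Defs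
open import Algebra.Properties.CommutativeSemigroup using (interchange)
open import Data.Empty using (⊥-elim)
open import Data.Fin using (Fin; toℕ; #_) renaming (zero to fzero; suc to fsuc)
import Data.Fin.Properties as Fin
open import Data.List using (List; []; _∷_; _++_; length; filter; applyUpTo)
open import Data.List.Membership.Propositional using (_∈_)
open import Data.List.Membership.Propositional.Properties
  using (∈-∃++; ∈-++⁻; ∈-++⁺ˡ; ∈-++⁺ʳ; ∈-filter⁻; ∈-applyUpTo⁺; ∈-applyUpTo⁻)
open import Data.List.Properties using (length-++; filter-++; filter-some)
open import Data.List.Relation.Binary.Disjoint.Propositional using (Disjoint)
open import Data.List.Relation.Binary.Subset.Propositional using (_⊆_)
open import Data.List.Relation.Binary.Subset.Propositional.Properties using (filter⁺′)
open import Data.List.Relation.Unary.All as All using (All; []; _∷_)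
open import Data.List.Relation.Unary.All.Properties using (++⁻ˡ; ++⁻ʳ)
open import Data.List.Relation.Unary.AllPairs using ([]; _∷_)
import Data.List.Relation.Unary.Any as Any
open import Data.List.Relation.Unary.Any using (here; there)
open import Data.List.Relation.Unary.Unique.Propositional using (Unique)
import Data.List.Relation.Unary.Unique.Propositional.Properties as Unique
open import Data.Nat
open import Data.Nat.Properties
open import Data.List.Membership.DecPropositional _≟_ using (_∈?_)
open import Data.List.Relation.Unary.Unique.DecPropositional _≟_ using (unique?)
open import Data.Nat.Tactic.RingSolver using (solve-∀)
open import Data.Product using (∃₂; _×_; _,_; proj₁; proj₂)
open import Data.Product.Properties using (≡-dec)
open import Data.Sum using (_⊎_; inj₁; inj₂; [_,_]′)
open import Data.Vec using (Vec; []; _∷_; lookup)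
open import Function using (_∘_; id; case_of_)
open import Function.Bundles using (_⇔_; Equivalence; mk⇔)
open import Relation.Binary using (tri<; tri≈; tri>)
open import Relation.Binary.PropositionalEquality
open import Relation.Nullary using (Dec; yes; no; ¬_; contradiction)
open import Relation.Nullary.Decidable using (from-yes; map′; ¬?; _×-dec_; _⊎-dec_; _→-dec_)

Unique-⊆⇒length≤ : ∀ {A : Set} {xs ys : List A} → Unique xs → xs ⊆ ys → length xs ≤ length ys
Unique-⊆⇒length≤ {xs = []} _ _ = z≤n
Unique-⊆⇒length≤ {xs = x ∷ xs} (x∉xs ∷ uniq) x∷xs⊆ys
  with as , bs , refl ← ∈-∃++ (x∷xs⊆ys (here refl)) = begin
    suc (length xs)             ≤⟨ s≤s (Unique-⊆⇒length≤ uniq xs⊆as++bs) ⟩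
    suc (length (as ++ bs))     ≡⟨ cong suc (length-++ as) ⟩
    suc (length as + length bs) ≡⟨ +-suc (length as) (length bs) ⟨
    length as + length (x ∷ bs) ≡⟨ length-++ as ⟨
    length (as ++ x ∷ bs)       ∎
  where
  open ≤-Reasoning
  xs⊆as++bs : xs ⊆ as ++ bs
  xs⊆as++bs v∈xs with ∈-++⁻ as (x∷xs⊆ys (there v∈xs))
  ... | inj₁ v∈as         = ∈-++⁺ˡ v∈as
  ... | inj₂ (here refl)  = contradiction refl (All.lookup x∉xs v∈xs)
  ... | inj₂ (there v∈bs) = ∈-++⁺ʳ as v∈bs

Unique-++⁻ : ∀ {A : Set} (xs : List A) {ys} → Unique (xs ++ ys) → Unique xs × Unique ys × Disjoint xs ys
Unique-++⁻ []       uniq         = [] , uniq , λ ()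
Unique-++⁻ (x ∷ xs) (x∉ ∷ uniq) with uxs , uys , disjoint ← Unique-++⁻ xs uniq =
  ++⁻ˡ xs x∉ ∷ uxs , uys , λ
    { (here refl , v∈ys)  → All.lookup (++⁻ʳ xs x∉) v∈ys refl
    ; (there v∈xs , v∈ys) → disjoint (v∈xs , v∈ys)
    }

two-ordered-members : ∀ {xs} → Unique xs → 2 ≤ length xs → ∃₂ λ u w → u ∈ xs × w ∈ xs × u < w
two-ordered-members {_ ∷ []} _ (s≤s ())
two-ordered-members {x ∷ y ∷ _} ((x≢y ∷ _) ∷ _) _ with <-cmp x y
... | tri< x<y _ _ = x , y , here refl , there (here refl) , x<y
... | tri≈ _ x≡y _ = contradiction x≡y x≢y
... | tri> _ _ y<x = y , x , there (here refl) , here refl , y<x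

-- Counting keys by weight

p≡7⊎p≡5⊎p≡0 : ∀ u → p u ≡ 7 ⊎ p u ≡ 5 ⊎ p u ≡ 0
p≡7⊎p≡5⊎p≡0 u with u <? 16
... | yes u<16 = from-yes (allUpTo? (λ u → p u ≟ 7 ⊎-dec p u ≟ 5 ⊎-dec p u ≟ 0) 16) u<16
... | no u≮16 = inj₂ (subst (λ v → p v ≡ 5 ⊎ p v ≡ 0) (m+[n∸m]≡n (≮⇒≥ u≮16)) (even-or-odd (u ∸ 16)))
  where
  even-or-odd : ∀ k → p (16 + k) ≡ 5 ⊎ p (16 + k) ≡ 0
  even-or-odd k with (16 + k) % 2
  ... | zero  = inj₁ refl
  ... | suc _ = inj₂ refl

count : ℕ → List ℕ → ℕ
count w = length ∘ filter (λ u → p u ≟ w)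

count⁺ : List ℕ → ℕ
count⁺ xs = count 7 xs + count 5 xs

count-++ : ∀ w xs ys → count w (xs ++ ys) ≡ count w xs + count w ys
count-++ w xs ys = trans (cong length (filter-++ (λ u → p u ≟ w) xs ys)) (length-++ (filter _ xs))

count⁺+count₀≡length : ∀ xs → count⁺ xs + count 0 xs ≡ length xs
count⁺+count₀≡length [] = refl
count⁺+count₀≡length (x ∷ xs) with p≡7⊎p≡5⊎p≡0 x
... | inj₁ px≡7 rewrite px≡7 = cong suc (count⁺+count₀≡length xs)
... | inj₂ (inj₁ px≡5) rewrite px≡5 =
  trans (cong (_+ count 0 xs) (+-suc (count 7 xs) (count 5 xs))) (cong suc (count⁺+count₀≡length xs))
... | inj₂ (inj₂ px≡0) rewrite px≡0 =
  trans (+-suc (count⁺ xs) (count 0 xs)) (cong suc (count⁺+count₀≡length xs))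

count-cover : ∀ w {U L H} → Unique U → U ⊆ L ++ H → count w U ≤ count w L + count w H
count-cover w {U} {L} {H} uniq U⊆L++H = begin
  count w U             ≤⟨ Unique-⊆⇒length≤ (Unique.filter⁺ P? uniq) (filter⁺′ P? P? id U⊆L++H) ⟩
  count w (L ++ H)      ≡⟨ count-++ w L H ⟩
  count w L + count w H ∎
  where
  open ≤-Reasoning
  P? = λ u → p u ≟ w

count-∈ : ∀ {w m xs} → m ∈ xs → p m ≡ w → 0 < count w xs
count-∈ {w} m∈xs pm≡w = filter-some (λ u → p u ≟ w) (Any.map (λ { refl → pm≡w }) m∈xs)

weight≡counts : ∀ T → weight T ≡ 7 * count 7 (leaves T) + 5 * count 5 (leaves T)
weight≡counts (leaf u) with p≡7⊎p≡5⊎p≡0 u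
... | inj₁ pu≡7        rewrite pu≡7 = refl
... | inj₂ (inj₁ pu≡5) rewrite pu≡5 = refl
... | inj₂ (inj₂ pu≡0) rewrite pu≡0 = refl
weight≡counts (node _ _ l r)
  rewrite weight≡counts l | weight≡counts r
        | count-++ 7 (leaves l) (leaves r) | count-++ 5 (leaves l) (leaves r) =
  regroup (count 7 (leaves l)) (count 5 (leaves l)) (count 7 (leaves r)) (count 5 (leaves r))
  where
  regroup : ∀ a b c d → (7 * a + 5 * b) + (7 * c + 5 * d) ≡ 7 * (a + c) + 5 * (b + d)
  regroup = solve-∀

costFrom-suc : ∀ d T → costFrom (suc d) T ≡ weight T + costFrom d T
costFrom-suc d (leaf u) = *-suc (p u) d
costFrom-suc d (node _ _ l r) = begin
  costFrom (2 + d) l + costFrom (2 + d) r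
    ≡⟨ cong₂ _+_ (costFrom-suc (suc d) l) (costFrom-suc (suc d) r) ⟩
  (weight l + costFrom (suc d) l) + (weight r + costFrom (suc d) r)
    ≡⟨ interchange +-commutativeSemigroup (weight l) _ (weight r) _ ⟩
  (weight l + weight r) + (costFrom (suc d) l + costFrom (suc d) r) ∎
  where open ≡-Reasoning

cost-node : ∀ o k l r → cost (node o k l r) ≡ (weight l + cost l) + (weight r + cost r)
cost-node o k l r = cong₂ _+_ (costFrom-suc 0 l) (costFrom-suc 0 r)

search∈leaves : ∀ T v → search T v ∈ leaves T
search∈leaves (leaf u) v = here refl
search∈leaves (node eqOp k l r) v with v ≟ k
... | yes _ = ∈-++⁺ˡ (search∈leaves l v)
... | no  _ = ∈-++⁺ʳ (leaves l) (search∈leaves r v)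
search∈leaves (node ltOp k l r) v with v <? k
... | yes _ = ∈-++⁺ˡ (search∈leaves l v)
... | no  _ = ∈-++⁺ʳ (leaves l) (search∈leaves r v)

search-< : ∀ {k l r v} → v < k → search (node ltOp k l r) v ≡ search l v
search-< {k} {v = v} v<k with v <? k
... | yes _   = refl
... | no v≮k = contradiction v<k v≮k

search-≮ : ∀ {k l r v} → ¬ v < k → search (node ltOp k l r) v ≡ search r v
search-≮ {k} {v = v} v≮k with v <? k
... | yes v<k = contradiction v<k v≮k
... | no _    = refl

search-≢ : ∀ {k l r v} → v ≢ k → search (node eqOp k l r) v ≡ search r v
search-≢ {k} {v = v} v≢k with v ≟ k
... | yes v≡k = contradiction v≡k v≢k
... | no _    = refl

-- The Huffman lower bound on capped weight profiles

cap : (k : ℕ) → ℕ → Fin (suc k)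
cap zero    n       = fzero
cap (suc k) zero    = fzero
cap (suc k) (suc n) = fsuc (cap k n)

toℕ-cap≤ : ∀ k n → toℕ (cap k n) ≤ n
toℕ-cap≤ zero    n       = z≤n
toℕ-cap≤ (suc k) zero    = z≤n
toℕ-cap≤ (suc k) (suc n) = s≤s (toℕ-cap≤ k n)

toℕ-cap<⇒≡ : ∀ k n → toℕ (cap k n) < k → toℕ (cap k n) ≡ n
toℕ-cap<⇒≡ (suc k) zero    _        = refl
toℕ-cap<⇒≡ (suc k) (suc n) (s≤s lt) = cong suc (toℕ-cap<⇒≡ k n lt)

toℕ-cap≡⇒≡ : ∀ k n i → toℕ (cap k n) ≡ i → i < k → n ≡ i
toℕ-cap≡⇒≡ k n i capped≡i i<k = trans (sym (toℕ-cap<⇒≡ k n (subst (_< k) (sym capped≡i) i<k))) capped≡i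

0<⇒0<toℕ-cap : ∀ k {n} → 0 < n → 0 < toℕ (cap (suc k) n)
0<⇒0<toℕ-cap k {suc n} _ = s≤s z≤n

cap-+ˡ : ∀ k m n → cap k (m + n) ≡ cap k (toℕ (cap k m) + n)
cap-+ˡ zero    m       n = refl
cap-+ˡ (suc k) zero    n = refl
cap-+ˡ (suc k) (suc m) n = cong fsuc (cap-+ˡ k m n)

cap-+ : ∀ k m n → cap k (m + n) ≡ cap k (toℕ (cap k m) + toℕ (cap k n))
cap-+ k m n = begin
  cap k (m + n)                         ≡⟨ cap-+ˡ k m n ⟩
  cap k (toℕ (cap k m) + n)             ≡⟨ cong (cap k) (+-comm (toℕ (cap k m)) n) ⟩
  cap k (n + toℕ (cap k m))             ≡⟨ cap-+ˡ k n _ ⟩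
  cap k (toℕ (cap k n) + toℕ (cap k m)) ≡⟨ cong (cap k) (+-comm (toℕ (cap k n)) _) ⟩
  cap k (toℕ (cap k m) + toℕ (cap k n)) ∎
  where open ≡-Reasoning

Profile : Set
Profile = Fin 5 × Fin 6 × Fin 2

profile : List ℕ → Profile
profile xs = cap 4 (count 7 xs) , cap 5 (count 5 xs) , cap 1 (count 0 xs)

_⊕_ : Profile → Profile → Profile
(x₁ , y₁ , z₁) ⊕ (x₂ , y₂ , z₂) =
  cap 4 (toℕ x₁ + toℕ x₂) , cap 5 (toℕ y₁ + toℕ y₂) , cap 1 (toℕ z₁ + toℕ z₂)

wt : Profile → ℕ
wt (x , y , _) = 7 * toℕ x + 5 * toℕ y

size : Profile → ℕ
size (x , y , z) = toℕ x + toℕ y + toℕ z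

_≟ₚ_ : (P Q : Profile) → Dec (P ≡ Q)
_≟ₚ_ = ≡-dec Fin._≟_ (≡-dec Fin._≟_ Fin._≟_)

allProfiles? : {A : Profile → Set} → (∀ P → Dec (A P)) → Dec (∀ P → A P)
allProfiles? A? = map′ (λ ∀A (x , y , z) → ∀A x y z) (λ ∀A x y z → ∀A (x , y , z))
  (Fin.all? λ x → Fin.all? λ y → Fin.all? λ z → A? (x , y , z))

profile-++ : ∀ xs ys → profile (xs ++ ys) ≡ profile xs ⊕ profile ys
profile-++ xs ys rewrite count-++ 7 xs ys | count-++ 5 xs ys | count-++ 0 xs ys =
  cong₂ _,_ (cap-+ 4 (count 7 xs) (count 7 ys))
    (cong₂ _,_ (cap-+ 5 (count 5 xs) (count 5 ys)) (cap-+ 1 (count 0 xs) (count 0 ys)))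

wt-profile≤weight : ∀ T → wt (profile (leaves T)) ≤ weight T
wt-profile≤weight T = begin
  wt (profile (leaves T))
    ≤⟨ +-mono-≤ (*-monoʳ-≤ 7 (toℕ-cap≤ 4 (count 7 (leaves T)))) (*-monoʳ-≤ 5 (toℕ-cap≤ 5 (count 5 (leaves T)))) ⟩
  7 * count 7 (leaves T) + 5 * count 5 (leaves T)
    ≡⟨ weight≡counts T ⟨
  weight T ∎
  where open ≤-Reasoning

size-profile≤length : ∀ xs → size (profile xs) ≤ length xs
size-profile≤length xs = begin
  size (profile xs)
    ≤⟨ +-mono-≤ (+-mono-≤ (toℕ-cap≤ 4 (count 7 xs)) (toℕ-cap≤ 5 (count 5 xs))) (toℕ-cap≤ 1 (count 0 xs)) ⟩
  count⁺ xs + count 0 xs ≡⟨ count⁺+count₀≡length xs ⟩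
  length xs              ∎
  where open ≤-Reasoning

-- Row a, column b holds the Huffman cost of a keys of weight 7 and b of weight 5, without and
-- with an extra key of weight 0.
huffmanTable : Vec (Vec (ℕ × ℕ) 6) 5
huffmanTable =
    ((0 , 0)   ∷ (0 , 5)   ∷ (10 , 15)   ∷ (25 , 30)   ∷ (40 , 45)   ∷ (60 , 65)   ∷ [])
  ∷ ((0 , 7)   ∷ (12 , 17) ∷ (27 , 32)   ∷ (44 , 49)   ∷ (64 , 69)   ∷ (84 , 89)   ∷ [])
  ∷ ((14 , 21) ∷ (31 , 36) ∷ (48 , 53)   ∷ (68 , 73)   ∷ (88 , 93)   ∷ (110 , 115) ∷ [])
  ∷ ((35 , 42) ∷ (52 , 57) ∷ (72 , 77)   ∷ (94 , 99)   ∷ (116 , 121) ∷ (138 , 143) ∷ [])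
  ∷ ((56 , 63) ∷ (78 , 83) ∷ (100 , 105) ∷ (122 , 127) ∷ (144 , 149) ∷ (169 , 174) ∷ [])
  ∷ []

huffman : Profile → ℕ
huffman (x , y , fzero)      = proj₁ (lookup (lookup huffmanTable x) y)
huffman (x , y , fsuc fzero) = proj₂ (lookup (lookup huffmanTable x) y)

huffman-⊕ : ∀ P Q → huffman (P ⊕ Q) ≤ (wt P + huffman P) + (wt Q + huffman Q)
huffman-⊕ = from-yes (allProfiles? λ P → allProfiles? λ Q →
  huffman (P ⊕ Q) ≤? (wt P + huffman P) + (wt Q + huffman Q))

huffman-singleton : ∀ u → huffman (profile (u ∷ [])) ≡ 0
huffman-singleton u with p≡7⊎p≡5⊎p≡0 u
... | inj₁ pu≡7        rewrite pu≡7 = refl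
... | inj₂ (inj₁ pu≡5) rewrite pu≡5 = refl
... | inj₂ (inj₂ pu≡0) rewrite pu≡0 = refl

children≤cost : ∀ o k l r →
  (wt (profile (leaves l)) + huffman (profile (leaves l))) + (wt (profile (leaves r)) + huffman (profile (leaves r)))
    ≤ cost (node o k l r)

huffman≤cost : ∀ T → huffman (profile (leaves T)) ≤ cost T
huffman≤cost (leaf u) = ≤-trans (≤-reflexive (huffman-singleton u)) z≤n
huffman≤cost (node o k l r) = begin
  huffman (profile (leaves l ++ leaves r))          ≡⟨ cong huffman (profile-++ (leaves l) (leaves r)) ⟩
  huffman (profile (leaves l) ⊕ profile (leaves r)) ≤⟨ huffman-⊕ (profile (leaves l)) (profile (leaves r)) ⟩
  _                                                 ≤⟨ children≤cost o k l r ⟩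
  cost (node o k l r)                               ∎
  where open ≤-Reasoning

children≤cost o k l r = begin
  _ ≤⟨ +-mono-≤ (+-mono-≤ (wt-profile≤weight l) (huffman≤cost l)) (+-mono-≤ (wt-profile≤weight r) (huffman≤cost r)) ⟩
  (weight l + cost l) + (weight r + cost r) ≡⟨ cost-node o k l r ⟨
  cost (node o k l r)                       ∎
  where open ≤-Reasoning

profile≡⟨1,3,1⟩⇒weight≡22 : ∀ T → profile (leaves T) ≡ (# 1 , # 3 , # 1) → weight T ≡ 22
profile≡⟨1,3,1⟩⇒weight≡22 T prof
  rewrite weight≡counts T
        | toℕ-cap≡⇒≡ 4 (count 7 (leaves T)) 1 (cong (toℕ ∘ proj₁) prof) (s≤s (s≤s z≤n))
        | toℕ-cap≡⇒≡ 5 (count 5 (leaves T)) 3 (cong (toℕ ∘ proj₁ ∘ proj₂) prof) (s≤s (s≤s (s≤s (s≤s z≤n)))) =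
  refl

-- The root of a tree whose weight-0 keys are closed downwards

Convex : List ℕ → List ℕ → Set
Convex C L = ∀ {u m w} → u ∈ C → w ∈ C → u < m → m < w → m ∈ L → m ∈ C

ZeroClosed : List ℕ → Set
ZeroClosed L = ∀ {m w} → w ∈ L → 1 ≤ m → m < w → p m ≡ 0 → m ∈ L

module CorrectNode {o k l r} (unique : Unique (leaves l ++ leaves r))
  (correct : ∀ {v} → v ∈ leaves l ++ leaves r → search (node o k l r) v ≡ v) where

  private
    disjoint : Disjoint (leaves l) (leaves r)
    disjoint = proj₂ (proj₂ (Unique-++⁻ (leaves l) unique))

  lands-left : ∀ {v} → v ∈ leaves l ++ leaves r → search (node o k l r) v ≡ search l v → v ∈ leaves l
  lands-left {v} v∈ routed = subst (_∈ leaves l) (trans (sym routed) (correct v∈)) (search∈leaves l v)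

  lands-right : ∀ {v} → v ∈ leaves l ++ leaves r → search (node o k l r) v ≡ search r v → v ∈ leaves r
  lands-right {v} v∈ routed = subst (_∈ leaves r) (trans (sym routed) (correct v∈)) (search∈leaves r v)

  stays-left : ∀ {v} → v ∈ leaves l → search (node o k l r) v ≢ search r v
  stays-left v∈l routed = disjoint (v∈l , lands-right (∈-++⁺ˡ v∈l) routed)

  stays-right : ∀ {v} → v ∈ leaves r → search (node o k l r) v ≢ search l v
  stays-right v∈r routed = disjoint (lands-left (∈-++⁺ʳ (leaves l) v∈r) routed , v∈r)

module _ {k l r} (unique : Unique (leaves l ++ leaves r))
  (correct : ∀ {v} → v ∈ leaves l ++ leaves r → search (node ltOp k l r) v ≡ v) where
  open CorrectNode {ltOp} {k} {l} {r} unique correct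

  lt-left<key : ∀ {v} → v ∈ leaves l → v < k
  lt-left<key {v} v∈l with v <? k
  ... | yes v<k = v<k
  ... | no v≮k  = contradiction (search-≮ v≮k) (stays-left v∈l)

  lt-right≮key : ∀ {v} → v ∈ leaves r → ¬ v < k
  lt-right≮key v∈r v<k = stays-right v∈r (search-< v<k)

  lt-children-convex : Convex (leaves l) (leaves l ++ leaves r) × Convex (leaves r) (leaves l ++ leaves r)
  lt-children-convex =
    (λ u∈l w∈l u<m m<w m∈ → lands-left m∈ (search-< (<-trans m<w (lt-left<key w∈l)))) ,
    (λ u∈r w∈r u<m m<w m∈ → lands-right m∈ (search-≮ (λ m<k → lt-right≮key u∈r (<-trans u<m m<k))))

module _ {k l r} (unique : Unique (leaves l ++ leaves r))
  (correct : ∀ {v} → v ∈ leaves l ++ leaves r → search (node eqOp k l r) v ≡ v) where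
  open CorrectNode {eqOp} {k} {l} {r} unique correct

  eq-left≡key : ∀ {v} → v ∈ leaves l → v ≡ k
  eq-left≡key {v} v∈l with v ≟ k
  ... | yes v≡k = v≡k
  ... | no v≢k  = contradiction (search-≢ v≢k) (stays-left v∈l)

  eq-left-length≤1 : length (leaves l) ≤ 1
  eq-left-length≤1 =
    Unique-⊆⇒length≤ {ys = k ∷ []} (proj₁ (Unique-++⁻ (leaves l) unique)) (here ∘ eq-left≡key)

five-before-zero : ∀ {u} → u < 14 → 1 ≤ u → p u ≡ 5 → p (suc u) ≡ 0
five-before-zero = from-yes (allUpTo? (λ u → 1 ≤? u →-dec (p u ≟ 5 →-dec p (suc u) ≟ 0)) 14)

convex-gap : ∀ {C L} → Unique C → C ⊆ L → Convex C L → ZeroClosed L → (∀ {v} → v ∈ L → Iℓ 14 v) →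
             2 ≤ count 5 C → 0 < count 0 C
convex-gap uniq C⊆L convex closed keys 2≤count₅
  with u , w , u∈ , w∈ , u<w ← two-ordered-members (Unique.filter⁺ (λ v → p v ≟ 5) uniq) 2≤count₅
  with u∈C , pu≡5 ← ∈-filter⁻ (λ v → p v ≟ 5) u∈
  with w∈C , pw≡5 ← ∈-filter⁻ (λ v → p v ≟ 5) w∈ =
  count-∈ (convex u∈C w∈C ≤-refl 1+u<w (closed (C⊆L w∈C) (s≤s z≤n) 1+u<w p[1+u]≡0)) p[1+u]≡0
  where
  p[1+u]≡0 : p (suc u) ≡ 0
  p[1+u]≡0 = five-before-zero (<-≤-trans u<w (proj₂ (keys (C⊆L w∈C)))) (proj₁ (keys (C⊆L u∈C))) pu≡5
  1+u<w : suc u < w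
  1+u<w = ≤∧≢⇒< u<w λ 1+u≡w → case trans (sym p[1+u]≡0) (trans (cong p 1+u≡w) pw≡5) of λ ()

Gapped : Profile → Set
Gapped (_ , y , z) = 2 ≤ toℕ y → 1 ≤ toℕ z

SplitShape : Profile → Profile → Set
SplitShape P Q = size P ≤ 1 ⊎ Gapped P × Gapped Q

convex⇒gapped : ∀ {C L} → Unique C → C ⊆ L → Convex C L → ZeroClosed L → (∀ {v} → v ∈ L → Iℓ 14 v) →
                Gapped (profile C)
convex⇒gapped {C} uniq C⊆L convex closed keys 2≤y =
  0<⇒0<toℕ-cap 0 (convex-gap uniq C⊆L convex closed keys (≤-trans 2≤y (toℕ-cap≤ 5 (count 5 C))))

root-splitShape : ∀ o k l r → Unique (leaves l ++ leaves r) →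
                  (∀ {v} → v ∈ leaves l ++ leaves r → search (node o k l r) v ≡ v) →
                  ZeroClosed (leaves l ++ leaves r) → (∀ {v} → v ∈ leaves l ++ leaves r → Iℓ 14 v) →
                  SplitShape (profile (leaves l)) (profile (leaves r))
root-splitShape ltOp k l r unique correct closed keys =
  inj₂ ( convex⇒gapped uniqueˡ ∈-++⁺ˡ convexˡ closed keys
       , convex⇒gapped uniqueʳ (∈-++⁺ʳ (leaves l)) convexʳ closed keys )
  where
  uniqueˡ = proj₁ (Unique-++⁻ (leaves l) unique)
  uniqueʳ = proj₁ (proj₂ (Unique-++⁻ (leaves l) unique))
  convexˡ = proj₁ (lt-children-convex {k} {l} {r} unique correct)
  convexʳ = proj₂ (lt-children-convex {k} {l} {r} unique correct)
root-splitShape eqOp k l r unique correct _ _ =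
  inj₁ (≤-trans (size-profile≤length (leaves l)) (eq-left-length≤1 {k} {l} {r} unique correct))

split-bound : ∀ P Q → P ⊕ Q ≡ (# 0 , # 4 , # 1) → SplitShape P Q →
              50 ≤ (wt P + huffman P) + (wt Q + huffman Q)
split-bound = from-yes (allProfiles? λ P → allProfiles? λ Q →
  (P ⊕ Q) ≟ₚ (# 0 , # 4 , # 1) →-dec (splitShape? P Q →-dec 50 ≤? (wt P + huffman P) + (wt Q + huffman Q)))
  where
  gapped? : ∀ P → Dec (Gapped P)
  gapped? (_ , y , z) = 2 ≤? toℕ y →-dec 1 ≤? toℕ z
  splitShape? : ∀ P Q → Dec (SplitShape P Q)
  splitShape? P Q = size P ≤? 1 ⊎-dec (gapped? P ×-dec gapped? Q)

zeroClosed⇒50≤cost : ∀ T → Unique (leaves T) → (∀ {v} → v ∈ leaves T → search T v ≡ v) →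
                     ZeroClosed (leaves T) → (∀ {v} → v ∈ leaves T → Iℓ 14 v) →
                     profile (leaves T) ≡ (# 0 , # 4 , # 1) → 50 ≤ cost T
zeroClosed⇒50≤cost (leaf u) _ _ _ _ prof =
  contradiction (subst (λ P → size P ≤ 1) prof (size-profile≤length (u ∷ []))) λ { (s≤s ()) }
zeroClosed⇒50≤cost (node o k l r) unique correct closed keys prof = begin
  50 ≤⟨ split-bound (profile (leaves l)) (profile (leaves r))
          (trans (sym (profile-++ (leaves l) (leaves r))) prof)
          (root-splitShape o k l r unique correct closed keys) ⟩
  _  ≤⟨ children≤cost o k l r ⟩
  cost (node o k l r) ∎
  where open ≤-Reasoning

-- The instances ℓ ≤ 14

range : ℕ → List ℕ
range ℓ = applyUpTo suc ℓ

∈-range⁻ : ∀ {ℓ v} → v ∈ range ℓ → Iℓ ℓ v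
∈-range⁻ v∈ with _ , i<ℓ , refl ← ∈-applyUpTo⁻ suc v∈ = s≤s z≤n , i<ℓ

∈-range⁺ : ∀ {ℓ v} → Iℓ ℓ v → v ∈ range ℓ
∈-range⁺ {v = suc i} (_ , i<ℓ) = ∈-applyUpTo⁺ suc i<ℓ

range-unique : ∀ ℓ → Unique (range ℓ)
range-unique ℓ = Unique.applyUpTo⁺₁ suc ℓ λ i<j _ 1+i≡1+j → <-irrefl (suc-injective 1+i≡1+j) i<j

Iℓ? : ∀ ℓ v → Dec (Iℓ ℓ v)
Iℓ? ℓ v = 1 ≤? v ×-dec v ≤? ℓ

validH? : ∀ ℓ h H → Dec (ValidH ℓ h H)
validH? ℓ h H = unique? H ×-dec All.all? (Iℓ? ℓ) H ×-dec length H ≟ h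

Certificate : ℕ → List ℕ → Tree → Set
Certificate ℓ H T = Unique (leaves T) × All (Diff ℓ H) (leaves T)
                  × All (λ v → v ∈ H ⊎ v ∈ leaves T) (range ℓ) × All (λ v → search T v ≡ v) (leaves T)

certificate? : ∀ ℓ H T → Dec (Certificate ℓ H T)
certificate? ℓ H T = unique? (leaves T)
  ×-dec All.all? (λ v → Iℓ? ℓ v ×-dec ¬? (v ∈? H)) (leaves T)
  ×-dec All.all? (λ v → v ∈? H ⊎-dec v ∈? leaves T) (range ℓ)
  ×-dec All.all? (λ v → search T v ≟ v) (leaves T)

Certificate⇒Correct : ∀ {ℓ H T} → Certificate ℓ H T → Correct (Diff ℓ H) T
Certificate⇒Correct {ℓ} {H} {T} (uniq , diff , cover , found) =
  uniq , (λ v → mk⇔ (All.lookup diff) from) , λ v → All.lookup found ∘ from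
  where
  from : ∀ {v} → Diff ℓ H v → v ∈ leaves T
  from (v∈I , v∉H) with All.lookup cover (∈-range⁺ v∈I)
  ... | inj₁ v∈H = contradiction v∈H v∉H
  ... | inj₂ v∈T = v∈T

equalityChain : ℕ → List ℕ → Tree
equalityChain k []        = leaf k
equalityChain k (k′ ∷ ks) = node eqOp k (leaf k) (equalityChain k′ ks)

witnessH : ℕ → List ℕ
witnessH ℓ = filter (λ v → 8 ≤? v ×-dec p v ≟ 5) (range ℓ)

-- Keys 1, 2, 4 at depth 2 and 6 at depth 3 give cost 14 + 10 + 10 + 15 = 49; the weight-0 keys
-- hang below 6 at no cost.
witness : ℕ → Tree
witness ℓ = node ltOp 3 (node eqOp 1 (leaf 1) (leaf 2))
                        (node eqOp 4 (leaf 4) (equalityChain 6 (filter (λ v → p v ≟ 0) (range ℓ))))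

Facts : ℕ → ℕ → Set
Facts ℓ h = count⁺ (range ℓ) ≡ 4 + h × 1 + h ≤ count 0 (range ℓ)
          × ValidH ℓ h (witnessH ℓ) × Certificate ℓ (witnessH ℓ) (witness ℓ) × cost (witness ℓ) ≡ 49

facts : ∀ {ℓ h} → ℓ ≤ 14 → h + 4 ≡ q ℓ → Facts ℓ h
facts {ℓ} {h} ℓ≤14 h+4≡q = subst (Facts ℓ) q∸4≡h (facts<15 (s≤s ℓ≤14) (subst (4 ≤_) h+4≡q (m≤n+m 4 h)))
  where
  facts<15 : ∀ {ℓ} → ℓ < 15 → 4 ≤ q ℓ → Facts ℓ (q ℓ ∸ 4)
  facts<15 = from-yes (allUpTo? (λ ℓ → 4 ≤? q ℓ →-dec
    (count⁺ (range ℓ) ≟ 4 + (q ℓ ∸ 4) ×-dec 1 + (q ℓ ∸ 4) ≤? count 0 (range ℓ)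
     ×-dec validH? ℓ (q ℓ ∸ 4) (witnessH ℓ) ×-dec certificate? ℓ (witnessH ℓ) (witness ℓ)
     ×-dec cost (witness ℓ) ≟ 49)) 15)
  q∸4≡h : q ℓ ∸ 4 ≡ h
  q∸4≡h = trans (cong (_∸ 4) (sym h+4≡q)) (m+n∸n≡m h 4)

cancel-≤ : ∀ {a b c d} → a + b ≤ c + d → d ≤ b → a ≤ c
cancel-≤ {a} {b} {c} {d} a+b≤c+d d≤b = +-cancelʳ-≤ b a c (≤-trans a+b≤c+d (+-monoʳ-≤ c d≤b))

Admissible : Profile → Set
Admissible (x , y , z) = 4 ≤ toℕ x + toℕ y × 1 ≤ toℕ z

4≤capped-sum : ∀ a b → 4 ≤ a + b → 4 ≤ toℕ (cap 4 a) + toℕ (cap 5 b)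
4≤capped-sum a b 4≤a+b with 4 ≤? toℕ (cap 4 a) + toℕ (cap 5 b)
... | yes 4≤ = 4≤
... | no 4≰ = contradiction (subst₂ (λ a′ b′ → 4 ≤ a′ + b′) (sym exact-a) (sym exact-b) 4≤a+b) 4≰
  where
  sum<4 = ≰⇒> 4≰
  exact-a = toℕ-cap<⇒≡ 4 a (≤-<-trans (m≤m+n _ _) sum<4)
  exact-b = toℕ-cap<⇒≡ 5 b (≤-<-trans (m≤n+m _ _) (m<n⇒m<1+n sum<4))

module SubproblemTree {ℓ h H T} (ℓ≤14 : ℓ ≤ 14) (valid : ValidH ℓ h H) (correct : Correct (Diff ℓ H) T)
  (positives : count⁺ (range ℓ) ≡ 4 + h) (zeros : 1 + h ≤ count 0 (range ℓ)) where

  private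
    leaf⇔ : ∀ v → v ∈ leaves T ⇔ Diff ℓ H v
    leaf⇔ = proj₁ (proj₂ correct)

    range⊆ : range ℓ ⊆ leaves T ++ H
    range⊆ {v} v∈ with v ∈? H
    ... | yes v∈H = ∈-++⁺ʳ (leaves T) v∈H
    ... | no  v∉H = ∈-++⁺ˡ (Equivalence.from (leaf⇔ v) (∈-range⁻ v∈ , v∉H))

    cover : ∀ w → count w (range ℓ) ≤ count w (leaves T) + count w H
    cover w = count-cover w {L = leaves T} {H} (range-unique ℓ) range⊆

    cover⁺ : count⁺ (range ℓ) ≤ count⁺ (leaves T) + count⁺ H
    cover⁺ = ≤-trans (+-mono-≤ (cover 7) (cover 5))
                     (≤-reflexive (interchange +-commutativeSemigroup (count 7 (leaves T)) _ _ _))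

    split-H : count⁺ H + count 0 H ≡ h
    split-H = trans (count⁺+count₀≡length H) (proj₂ (proj₂ valid))

  keys : ∀ {v} → v ∈ leaves T → Iℓ 14 v
  keys {v} v∈T with (1≤v , v≤ℓ) , _ ← Equivalence.to (leaf⇔ v) v∈T = 1≤v , ≤-trans v≤ℓ ℓ≤14

  found : ∀ {v} → v ∈ leaves T → search T v ≡ v
  found {v} = proj₂ (proj₂ correct) v ∘ Equivalence.to (leaf⇔ v)

  admissible : Admissible (profile (leaves T))
  admissible = 4≤capped-sum (count 7 (leaves T)) (count 5 (leaves T)) 4≤count⁺ , 0<⇒0<toℕ-cap 0 1≤count₀
    where
    4≤count⁺ = cancel-≤ (subst (_≤ count⁺ (leaves T) + count⁺ H) positives cover⁺)
                        (≤-trans (m≤m+n (count⁺ H) (count 0 H)) (≤-reflexive split-H))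
    1≤count₀ = cancel-≤ (≤-trans zeros (cover 0)) (≤-trans (m≤n+m (count 0 H) (count⁺ H)) (≤-reflexive split-H))

  -- With only four positive leaves, H is made of the h remaining positive keys.
  zeroClosed : count⁺ (leaves T) ≡ 4 → ZeroClosed (leaves T)
  zeroClosed tight {m} w∈T 1≤m m<w pm≡0 with m ∈? H
  ... | no m∉H = Equivalence.from (leaf⇔ m) ((1≤m , <⇒≤ (<-≤-trans m<w w≤ℓ)) , m∉H)
    where w≤ℓ = proj₂ (proj₁ (Equivalence.to (leaf⇔ _) w∈T))
  ... | yes m∈H = contradiction (+-cancelˡ-≤ (count⁺ H) 1 0 count⁺H+1≤count⁺H+0) λ ()
    where
    open ≤-Reasoning
    h≤count⁺H : h ≤ count⁺ H
    h≤count⁺H = +-cancelˡ-≤ 4 h (count⁺ H) (subst₂ (λ a b → a ≤ b + count⁺ H) positives tight cover⁺)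
    count⁺H+1≤count⁺H+0 : count⁺ H + 1 ≤ count⁺ H + 0
    count⁺H+1≤count⁺H+0 = begin
      count⁺ H + 1         ≤⟨ +-monoʳ-≤ (count⁺ H) (count-∈ m∈H pm≡0) ⟩
      count⁺ H + count 0 H ≡⟨ split-H ⟩
      h                    ≤⟨ h≤count⁺H ⟩
      count⁺ H             ≡⟨ +-identityʳ (count⁺ H) ⟨
      count⁺ H + 0         ∎

  profile≡⟨0,4,1⟩⇒50≤cost : profile (leaves T) ≡ (# 0 , # 4 , # 1) → 50 ≤ cost T
  profile≡⟨0,4,1⟩⇒50≤cost prof = zeroClosed⇒50≤cost T (proj₁ correct) found (zeroClosed tight) keys prof
    where
    tight = cong₂ _+_ (toℕ-cap≡⇒≡ 4 (count 7 (leaves T)) 0 (cong (toℕ ∘ proj₁) prof) (s≤s z≤n))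
                      (toℕ-cap≡⇒≡ 5 (count 5 (leaves T)) 4 (cong (toℕ ∘ proj₁ ∘ proj₂) prof)
                                  (s≤s (s≤s (s≤s (s≤s (s≤s z≤n))))))

cheap-profiles : ∀ P → Admissible P → huffman P ≤ 49 → P ≡ (# 1 , # 3 , # 1) ⊎ P ≡ (# 0 , # 4 , # 1)
cheap-profiles = from-yes (allProfiles? λ P → admissible? P →-dec (huffman P ≤? 49 →-dec
  (P ≟ₚ (# 1 , # 3 , # 1) ⊎-dec P ≟ₚ (# 0 , # 4 , # 1))))
  where
  admissible? : ∀ P → Dec (Admissible P)
  admissible? (x , y , z) = 4 ≤? toℕ x + toℕ y ×-dec 1 ≤? toℕ z

lemma3 : (ℓ h′ : ℕ) (T′ : Tree) → 1 ≤ ℓ → ℓ ≤ 14 → h′ + 4 ≡ q ℓ →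
    Optimal ℓ h′ T′ → (weight T′ ≡ 22) × (cost T′ ≡ 49)
lemma3 ℓ h′ T′ _ ℓ≤14 h′+4≡q ((H , valid , correct) , optimal)
  with positives , zeros , validW , certifiedW , costW ← facts ℓ≤14 h′+4≡q =
  [ (λ prof → profile≡⟨1,3,1⟩⇒weight≡22 T′ prof
            , ≤-antisym cost≤49 (subst (_≤ cost T′) (cong huffman prof) (huffman≤cost T′)))
  , (λ prof → ⊥-elim (<⇒≱ (s≤s cost≤49) (profile≡⟨0,4,1⟩⇒50≤cost prof)))
  ]′ (cheap-profiles (profile (leaves T′)) admissible (≤-trans (huffman≤cost T′) cost≤49))
  where
  open SubproblemTree {T = T′} ℓ≤14 valid correct positives zeros
  cost≤49 : cost T′ ≤ 49
  cost≤49 = subst (cost T′ ≤_) costW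
    (optimal (witness ℓ) (witnessH ℓ , validW , Certificate⇒Correct {T = witness ℓ} certifiedW))
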